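{- For all $n,p\ge1$, $\textsc{DADP}(n,p)\le\textsc{UDP}(n,p)$.
   Context: Graphs have nonnegative real edge weights. Given a graph $G$ and a set $P\subseteq V(G)\times V(G)$ of demand pairs such that $t$ is reachable from $s$ for every $(s,t)\in P$, an (exact) distance preserver of $G,P$ is a subgraph $H$ of $G$ with $\mathrm{dist}_H(s,t)=\mathrm{dist}_G(s,t)$ for all $(s,t)\in P$. $\textsc{DADP}(n,p)$ (resp. $\textsc{UDP}(n,p)$) denotes the maximum, over all $n$-node directed acyclic (resp. undirected) weighted graphs $G$ and all sets $P$ of $p$ demand pairs, of the minimum number of edges of an exact distance preserver of $G,P$. -}

module Defs where

open import Level using (0ℓ)
open import Data.Nat as ℕ using (ℕ)
open import Data.Fin using (Fin)
open import Data.Product using (Σ; ∃; _×_; _,_)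
open import Data.Sum using (_⊎_)
open import Data.List using (List; []; _∷_; length)
open import Data.List.Membership.Propositional using (_∈_)
open import Data.List.Relation.Unary.All using (All)
open import Data.List.Relation.Unary.AllPairs using (AllPairs)
open import Data.List.Relation.Binary.Sublist.Propositional using (_⊆_)
open import Relation.Binary.PropositionalEquality using (_≡_; _≢_)
open import Relation.Nullary using (¬_)

-- The real numbers, axiomatised as a (Dedekind-)complete totally ordered
-- field.  Any two such structures are isomorphic, so quantifying over all
-- of them amounts to speaking about ℝ.
record RealField : Set₁ where
  infixl 6 _+_
  infixl 7 _*_
  infix 4 _≤_
  field
    Carrier : Set
    0# 1#   : Carrier
    _+_ _*_ : Carrier → Carrier → Carrier
    -_      : Carrier → Carrier
    _≤_     : Carrier → Carrier → Set
    +-assoc    : ∀ x y z → (x + y) + z ≡ x + (y + z)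
    +-comm     : ∀ x y → x + y ≡ y + x
    +-identity : ∀ x → 0# + x ≡ x
    +-inverse  : ∀ x → x + (- x) ≡ 0#
    *-assoc    : ∀ x y z → (x * y) * z ≡ x * (y * z)
    *-comm     : ∀ x y → x * y ≡ y * x
    *-identity : ∀ x → 1# * x ≡ x
    distrib    : ∀ x y z → x * (y + z) ≡ (x * y) + (x * z)
    0≢1        : 0# ≢ 1#
    *-inverse  : ∀ x → x ≢ 0# → Σ Carrier (λ y → x * y ≡ 1#)
    ≤-refl     : ∀ x → x ≤ x
    ≤-trans    : ∀ {x y z} → x ≤ y → y ≤ z → x ≤ z
    ≤-antisym  : ∀ {x y} → x ≤ y → y ≤ x → x ≡ y
    ≤-total    : ∀ x y → (x ≤ y) ⊎ (y ≤ x)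
    +-mono-≤   : ∀ {x y} z → x ≤ y → x + z ≤ y + z
    *-nonneg   : ∀ {x y} → 0# ≤ x → 0# ≤ y → 0# ≤ x * y
    complete   : (S : Carrier → Set) → Σ Carrier S →
                 Σ Carrier (λ b → ∀ x → S x → x ≤ b) →
                 Σ Carrier (λ u → (∀ x → S x → x ≤ u) ×
                                  (∀ b → (∀ x → S x → x ≤ b) → u ≤ b))

module WithReals (ℝ : RealField) where
  open RealField ℝ

  -- A weighted edge between vertices of Fin n.  For directed graphs it goes
  -- from src to tgt; for undirected graphs the orientation is irrelevant.
  record Edge (n : ℕ) : Set where
    constructor edge
    field
      src tgt : Fin n
      wt      : Carrier
  open Edge public

  -- A weighted graph on vertex set Fin n is given by its list of edges;
  -- a subgraph H of G is a sublist of G's edge list, and |E(H)| = length H.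
  Graph : ℕ → Set
  Graph n = List (Edge n)

  NonnegWeights : ∀ {n} → Graph n → Set
  NonnegWeights G = All (λ e → 0# ≤ wt e) G

  data DWalk {n} (G : Graph n) : Fin n → Fin n → Set where
    [] : ∀ {v} → DWalk G v v
    _∷_ : ∀ {e t} → e ∈ G → DWalk G (tgt e) t → DWalk G (src e) t

  data UWalk {n} (G : Graph n) : Fin n → Fin n → Set where
    [] : ∀ {v} → UWalk G v v
    fwd : ∀ {e t} → e ∈ G → UWalk G (tgt e) t → UWalk G (src e) t
    bwd : ∀ {e t} → e ∈ G → UWalk G (src e) t → UWalk G (tgt e) t

  dweight : ∀ {n} {G : Graph n} {s t} → DWalk G s t → Carrier
  dweight [] = 0#
  dweight (_∷_ {e} _ w) = wt e + dweight w

  uweight : ∀ {n} {G : Graph n} {s t} → UWalk G s t → Carrier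
  uweight [] = 0#
  uweight (fwd {e} _ w) = wt e + uweight w
  uweight (bwd {e} _ w) = wt e + uweight w

  IsDDist : ∀ {n} → Graph n → Fin n → Fin n → Carrier → Set
  IsDDist G s t d = Σ (DWalk G s t) (λ w → dweight w ≡ d) ×
                    (∀ (w : DWalk G s t) → d ≤ dweight w)

  IsUDist : ∀ {n} → Graph n → Fin n → Fin n → Carrier → Set
  IsUDist G s t d = Σ (UWalk G s t) (λ w → uweight w ≡ d) ×
                    (∀ (w : UWalk G s t) → d ≤ uweight w)

  SimpleD : ∀ {n} → Graph n → Set
  SimpleD G = AllPairs (λ e f → ¬ (src e ≡ src f × tgt e ≡ tgt f)) G

  Acyclic : ∀ {n} → Graph n → Set
  Acyclic G = ∀ {e} → e ∈ G → ¬ DWalk G (tgt e) (src e)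

  SimpleU : ∀ {n} → Graph n → Set
  SimpleU G = All (λ e → src e ≢ tgt e) G ×
              AllPairs (λ e f → ¬ ((src e ≡ src f × tgt e ≡ tgt f) ⊎
                                   (src e ≡ tgt f × tgt e ≡ src f))) G

  record DAG (n : ℕ) : Set where
    field
      edges   : Graph n
      nonneg  : NonnegWeights edges
      simple  : SimpleD edges
      acyclic : Acyclic edges

  record UGraph (n : ℕ) : Set where
    field
      edges   : Graph n
      nonneg  : NonnegWeights edges
      simple  : SimpleU edges

  Demands : ℕ → Set
  Demands n = List (Fin n × Fin n)

  DistinctPairs : ∀ {n} → Demands n → Set
  DistinctPairs P = AllPairs (λ a b → ¬ a ≡ b) P

  ValidD : ∀ {n} → Graph n → ℕ → Demands n → Set
  ValidD G p P = length P ≡ p × DistinctPairs P ×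
                 All (λ { (s , t) → DWalk G s t }) P

  ValidU : ∀ {n} → Graph n → ℕ → Demands n → Set
  ValidU G p P = length P ≡ p × DistinctPairs P ×
                 All (λ { (s , t) → UWalk G s t }) P

  DPreserver : ∀ {n} → Graph n → Demands n → Graph n → Set
  DPreserver G P H = H ⊆ G ×
    All (λ { (s , t) → Σ Carrier (λ d → IsDDist G s t d × IsDDist H s t d) }) P

  UPreserver : ∀ {n} → Graph n → Demands n → Graph n → Set
  UPreserver G P H = H ⊆ G ×
    All (λ { (s , t) → Σ Carrier (λ d → IsUDist G s t d × IsUDist H s t d) }) P

  -- DADP(n,p) ≤ k : every instance has an exact preserver with ≤ k edges.
  DADP≤ : ℕ → ℕ → ℕ → Set
  DADP≤ n p k = (G : DAG n) (P : Demands n) → ValidD (DAG.edges G) p P →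
    Σ (Graph n) (λ H → DPreserver (DAG.edges G) P H × length H ℕ.≤ k)

  UDP≤ : ℕ → ℕ → ℕ → Set
  UDP≤ n p k = (G : UGraph n) (P : Demands n) → ValidU (UGraph.edges G) p P →
    Σ (Graph n) (λ H → UPreserver (UGraph.edges G) P H × length H ℕ.≤ k)

-- Rank every vertex of the DAG by the number of steps of a longest walk leaving it, so that
-- each edge strictly lowers the rank, and add φ u - φ v to the weight of each edge u → v, where
-- φ = M · rank and 2M exceeds the weight of a chosen walk for every demand pair. A directed
-- s-t walk then gains exactly φ s - φ t, whereas every backward step along an edge costs at
-- least 2M extra. Hence, in the reweighted undirected graph and in each of its subgraphs that
-- preserves the demand distances, a shortest s-t walk is a directed walk shifted by φ s - φ t,
-- so an undirected preserver is a directed preserver with the same edges.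
module Submission where

open import Level using (0ℓ)
open import Function using (_∘_; id)
open import Data.Nat as ℕ using (ℕ; zero; suc; z≤n; s≤s; _<_)
open import Data.Nat.Properties using (m≤n⇒∃[o]m+o≡n; <⇒≤)
import Data.Nat.Properties as ℕₚ
open import Data.Fin using (Fin; _≟_)
open import Data.Fin.Properties using (injective⇒≤)
open import Data.Product using (Σ; ∃; ∃₂; _×_; _,_; proj₁; proj₂)
open import Data.Sum using (inj₁; inj₂; [_,_]′)
open import Data.Maybe using (nothing)
open import Data.Empty using (⊥-elim)
open import Data.List using (List; []; _∷_; length; map; filter; lookup)
open import Data.List.Properties using (length-map)
open import Data.List.Extrema.Nat using (max; argmax-sel; xs≤max)
open import Data.List.Membership.Propositional using (_∈_)
open import Data.List.Membership.Propositional.Properties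
  using (∈-map⁺; ∈-map⁻; ∈-filter⁺; ∈-filter⁻; ∈-lookup)
open import Data.List.Relation.Unary.Any using (here; there)
open import Data.List.Relation.Unary.All as All using (All; []; _∷_)
open import Data.List.Relation.Unary.All.Properties as All using (¬Any⇒All¬)
open import Data.List.Relation.Unary.AllPairs as AllPairs using (AllPairs; []; _∷_)
import Data.List.Relation.Unary.AllPairs.Properties as AllPairs
open import Data.List.Relation.Unary.Unique.Propositional using (Unique)
open import Data.List.Relation.Binary.Sublist.Propositional as Sublist using (_⊆_; []; _∷_; _∷ʳ_)
open import Data.List.Relation.Binary.Sublist.Propositional.Properties using (All-resp-⊆)
open import Relation.Binary.PropositionalEquality
  using (_≡_; _≢_; refl; sym; trans; cong; cong₂; subst; isEquivalence)
open import Relation.Binary.Bundles using (Poset)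
open import Relation.Nullary using (¬_)
open import Algebra.Bundles using (CommutativeRing)
open import Algebra.Structures using (IsCommutativeRing)
open import Algebra.Consequences.Propositional
  using (comm∧idˡ⇒id; comm∧invʳ⇒inv; comm∧distrˡ⇒distrʳ)
import Algebra.Properties.Monoid.Mult as MonoidMult
import Algebra.Properties.Ring as RingProperties
import Algebra.Properties.CommutativeSemigroup as CommutativeSemigroupProperties
open import Tactic.RingSolver.Core.AlmostCommutativeRing
  using (AlmostCommutativeRing; fromCommutativeRing)
open import Tactic.RingSolver using (solve-∀)

open import Defs

lookup-injective : ∀ {A : Set} {xs : List A} → Unique xs →
                   ∀ {i j} → lookup xs i ≡ lookup xs j → i ≡ j
lookup-injective (_ ∷ _) {Fin.zero} {Fin.zero} _ = refl
lookup-injective (x∉xs ∷ _) {Fin.zero} {Fin.suc j} eq =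
  ⊥-elim (All.lookup x∉xs (∈-lookup j) eq)
lookup-injective (x∉xs ∷ _) {Fin.suc i} {Fin.zero} eq =
  ⊥-elim (All.lookup x∉xs (∈-lookup i) (sym eq))
lookup-injective (_ ∷ xs!) {Fin.suc i} {Fin.suc j} eq = cong Fin.suc (lookup-injective xs! eq)

unique⇒length≤ : ∀ {n} {xs : List (Fin n)} → Unique xs → length xs ℕ.≤ n
unique⇒length≤ xs! = injective⇒≤ (lookup-injective xs!)

allPairs-tabulate : ∀ {A : Set} {R : A → A → Set} {xs : List A} →
                    (∀ {x y} → x ∈ xs → y ∈ xs → R x y) → AllPairs R xs
allPairs-tabulate {xs = []} _ = []
allPairs-tabulate {xs = x ∷ xs} r =
  All.tabulate (r (here refl) ∘ there) ∷
  allPairs-tabulate (λ x∈xs y∈xs → r (there x∈xs) (there y∈xs))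

sublist-of-map : ∀ {A B : Set} {f : A → B} {xs : List B} (ys : List A) →
                 xs ⊆ map f ys → ∃ λ zs → xs ≡ map f zs × zs ⊆ ys
sublist-of-map [] [] = [] , refl , []
sublist-of-map (y ∷ ys) (_ ∷ʳ xs⊆) with sublist-of-map ys xs⊆
... | zs , refl , zs⊆ = zs , refl , y ∷ʳ zs⊆
sublist-of-map (y ∷ ys) (refl ∷ xs⊆) with sublist-of-map ys xs⊆
... | zs , refl , zs⊆ = y ∷ zs , refl , refl ∷ zs⊆

module RealFieldProperties (ℝ : RealField) where
  private
    module ℝ = RealField ℝ
  open RealField ℝ public
    using (Carrier; _≤_; ≤-refl; ≤-trans; ≤-antisym; ≤-total; *-nonneg; 0≢1)
    renaming (+-mono-≤ to +-monoˡ-≤)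

  +-*-isCommutativeRing : IsCommutativeRing _≡_ ℝ._+_ ℝ._*_ ℝ.-_ ℝ.0# ℝ.1#
  +-*-isCommutativeRing = record
    { isRing = record
      { +-isAbelianGroup = record
        { isGroup = record
          { isMonoid = record
            { isSemigroup = record
              { isMagma = record { isEquivalence = isEquivalence ; ∙-cong = cong₂ ℝ._+_ }
              ; assoc = ℝ.+-assoc
              }
            ; identity = comm∧idˡ⇒id ℝ.+-comm ℝ.+-identity
            }
          ; inverse = comm∧invʳ⇒inv ℝ.+-comm ℝ.+-inverse
          ; ⁻¹-cong = cong ℝ.-_
          }
        ; comm = ℝ.+-comm
        }
      ; *-cong = cong₂ ℝ._*_
      ; *-assoc = ℝ.*-assoc
      ; *-identity = comm∧idˡ⇒id ℝ.*-comm ℝ.*-identity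
      ; distrib = ℝ.distrib , comm∧distrˡ⇒distrʳ ℝ.*-comm ℝ.distrib
      }
    ; *-comm = ℝ.*-comm
    }

  +-*-commutativeRing : CommutativeRing 0ℓ 0ℓ
  +-*-commutativeRing = record { isCommutativeRing = +-*-isCommutativeRing }

  -- With no way to decide 0# ≡ x, the solver cannot cancel terms, so it is used only for
  -- identities without subtraction.
  almostCommutativeRing : AlmostCommutativeRing 0ℓ 0ℓ
  almostCommutativeRing = fromCommutativeRing +-*-commutativeRing (λ _ → nothing)

  open AlmostCommutativeRing almostCommutativeRing public using (_+_; _*_; -_; _-_; 0#; 1#)
  open CommutativeRing +-*-commutativeRing public
    using (+-assoc; +-comm; +-identityˡ; +-identityʳ; -‿inverseˡ; -‿inverseʳ)
  open CommutativeSemigroupProperties (CommutativeRing.+-commutativeSemigroup +-*-commutativeRing) public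
    using (interchange; x∙yz≈y∙xz)
  open RingProperties (CommutativeRing.ring +-*-commutativeRing) using (-1*x≈-x; -‿involutive)
  open MonoidMult (CommutativeRing.+-monoid +-*-commutativeRing) public
    using () renaming (_×_ to _·_; ×-homo-+ to ·-homo-+)

  ≤-poset : Poset 0ℓ 0ℓ 0ℓ
  ≤-poset = record
    { isPartialOrder = record
      { isPreorder = record
        { isEquivalence = isEquivalence
        ; reflexive = λ { refl → ≤-refl _ }
        ; trans = ≤-trans
        }
      ; antisym = ≤-antisym
      }
    }

  open import Relation.Binary.Reasoning.PartialOrder ≤-poset public

  [x-y]+[y-z]≡x-z : ∀ x y z → (x - y) + (y - z) ≡ x - z
  [x-y]+[y-z]≡x-z x y z = begin-equality
    (x - y) + (y - z)       ≡⟨ regroup x (- y) y (- z) ⟩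
    x + ((- y + y) - z)     ≡⟨ cong (λ a → x + (a - z)) (-‿inverseˡ y) ⟩
    x + (0# - z)            ≡⟨ cong (x +_) (+-identityˡ (- z)) ⟩
    x - z                   ∎
    where
    regroup : ∀ a b c d → (a + b) + (c + d) ≡ a + ((b + c) + d)
    regroup = solve-∀ almostCommutativeRing

  [x+y]-y≡x : ∀ x y → (x + y) - y ≡ x
  [x+y]-y≡x x y = begin-equality
    (x + y) - y   ≡⟨ +-assoc x y (- y) ⟩
    x + (y - y)   ≡⟨ cong (x +_) (-‿inverseʳ y) ⟩
    x + 0#        ≡⟨ +-identityʳ x ⟩
    x             ∎

  +-monoʳ-≤ : ∀ x {y z} → y ≤ z → x + y ≤ x + z
  +-monoʳ-≤ x {y} {z} y≤z = begin
    x + y   ≡⟨ +-comm x y ⟩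
    y + x   ≤⟨ +-monoˡ-≤ x y≤z ⟩
    z + x   ≡⟨ +-comm z x ⟩
    x + z   ∎

  +-mono-≤ : ∀ {x y u v} → x ≤ y → u ≤ v → x + u ≤ y + v
  +-mono-≤ {y = y} {u} x≤y u≤v = ≤-trans (+-monoˡ-≤ u x≤y) (+-monoʳ-≤ y u≤v)

  +-cancelʳ-≤ : ∀ z {x y} → x + z ≤ y + z → x ≤ y
  +-cancelʳ-≤ z {x} {y} x+z≤y+z = begin
    x             ≡⟨ [x+y]-y≡x x z ⟨
    (x + z) - z   ≤⟨ +-monoˡ-≤ (- z) x+z≤y+z ⟩
    (y + z) - z   ≡⟨ [x+y]-y≡x y z ⟩
    y             ∎

  +-cancelˡ-≤ : ∀ z {x y} → z + x ≤ z + y → x ≤ y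
  +-cancelˡ-≤ z {x} {y} z+x≤z+y = +-cancelʳ-≤ z (begin
    x + z   ≡⟨ +-comm x z ⟩
    z + x   ≤⟨ z+x≤z+y ⟩
    z + y   ≡⟨ +-comm z y ⟩
    y + z   ∎)

  x+y≤z⇒y≤z-x : ∀ {x y z} → x + y ≤ z → y ≤ z - x
  x+y≤z⇒y≤z-x {x} {y} {z} x+y≤z = begin
    y             ≡⟨ [x+y]-y≡x y x ⟨
    (y + x) - x   ≡⟨ cong (_- x) (+-comm y x) ⟩
    (x + y) - x   ≤⟨ +-monoˡ-≤ (- x) x+y≤z ⟩
    z - x         ∎

  x≤y+x : ∀ {x y} → 0# ≤ y → x ≤ y + x
  x≤y+x {x} {y} 0≤y = begin
    x        ≡⟨ +-identityˡ x ⟨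
    0# + x   ≤⟨ +-monoˡ-≤ x 0≤y ⟩
    y + x    ∎

  x≤x+y : ∀ {x y} → 0# ≤ y → x ≤ x + y
  x≤x+y {x} {y} 0≤y = subst (x ≤_) (+-comm y x) (x≤y+x 0≤y)

  +-nonneg : ∀ {x y} → 0# ≤ x → 0# ≤ y → 0# ≤ x + y
  +-nonneg 0≤x 0≤y = ≤-trans 0≤y (x≤y+x 0≤x)

  0≤1 : 0# ≤ 1#
  0≤1 with ≤-total 0# 1#
  ... | inj₁ 0≤1 = 0≤1
  ... | inj₂ 1≤0 = begin
    0#                ≤⟨ *-nonneg 0≤-1 0≤-1 ⟩
    (- 1#) * (- 1#)   ≡⟨ -1*x≈-x (- 1#) ⟩
    - (- 1#)          ≡⟨ -‿involutive 1# ⟩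
    1#                ∎
    where
    0≤-1 : 0# ≤ - 1#
    0≤-1 = begin
      0#        ≡⟨ -‿inverseʳ 1# ⟨
      1# - 1#   ≤⟨ +-monoˡ-≤ (- 1#) 1≤0 ⟩
      0# - 1#   ≡⟨ +-identityˡ (- 1#) ⟩
      - 1#      ∎

  [1+x]+[1+x]≰x : ∀ {x} → 0# ≤ x → ¬ ((1# + x) + (1# + x) ≤ x)
  [1+x]+[1+x]≰x {x} 0≤x too-big = 0≢1 (≤-antisym 0≤1 1≤0)
    where
    regroup : ∀ a b → (a + b) + (a + b) ≡ (a + (a + b)) + b
    regroup = solve-∀ almostCommutativeRing
    1≤0 : 1# ≤ 0#
    1≤0 = begin
      1#              ≡⟨ +-identityʳ 1# ⟨
      1# + 0#         ≤⟨ +-monoʳ-≤ 1# (+-nonneg 0≤1 0≤x) ⟩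
      1# + (1# + x)   ≤⟨ +-cancelʳ-≤ x (begin
        (1# + (1# + x)) + x   ≡⟨ regroup 1# x ⟨
        (1# + x) + (1# + x)   ≤⟨ too-big ⟩
        x                     ≡⟨ +-identityˡ x ⟨
        0# + x                ∎) ⟩
      0#              ∎

  ·-nonneg : ∀ {x} k → 0# ≤ x → 0# ≤ k · x
  ·-nonneg zero 0≤x = ≤-refl 0#
  ·-nonneg (suc k) 0≤x = +-nonneg 0≤x (·-nonneg k 0≤x)

  m<n⇒m·x+x≤n·x : ∀ {x m n} → 0# ≤ x → m < n → m · x + x ≤ n · x
  m<n⇒m·x+x≤n·x {x} {m} {n} 0≤x m<n with m≤n⇒∃[o]m+o≡n m<n
  ... | o , refl = begin
    m · x + x           ≡⟨ +-comm (m · x) x ⟩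
    x + m · x           ≤⟨ x≤x+y (·-nonneg o 0≤x) ⟩
    (x + m · x) + o · x ≡⟨ ·-homo-+ x (suc m) o ⟨
    (suc m ℕ.+ o) · x   ∎

  module _ {A : Set} {P : A → Set} (f : ∀ {x} → P x → Carrier) where

    ∑ : ∀ {xs} → All P xs → Carrier
    ∑ [] = 0#
    ∑ (p ∷ ps) = f p + ∑ ps

    module _ (f-nonneg : ∀ {x} (p : P x) → 0# ≤ f p) where

      ∑-nonneg : ∀ {xs} (ps : All P xs) → 0# ≤ ∑ ps
      ∑-nonneg [] = ≤-refl 0#
      ∑-nonneg (p ∷ ps) = +-nonneg (f-nonneg p) (∑-nonneg ps)

      lookup≤∑ : ∀ {xs x} (ps : All P xs) (x∈xs : x ∈ xs) →
                 f (All.lookup ps x∈xs) ≤ ∑ ps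
      lookup≤∑ (p ∷ ps) (here refl) = x≤x+y (∑-nonneg ps)
      lookup≤∑ (p ∷ ps) (there x∈xs) = ≤-trans (lookup≤∑ ps x∈xs) (x≤y+x (f-nonneg p))

module Walks (ℝ : RealField) {n : ℕ} where
  open WithReals ℝ
  open RealFieldProperties ℝ

  steps : ∀ {G : Graph n} {a b} → DWalk G a b → ℕ
  steps [] = 0
  steps (_ ∷ w) = suc (steps w)

  weaken : ∀ {K G : Graph n} {a b} → K ⊆ G → DWalk K a b → DWalk G a b
  weaken K⊆G [] = []
  weaken K⊆G (e∈K ∷ w) = Sublist.lookup K⊆G e∈K ∷ weaken K⊆G w

  dweight-weaken : ∀ {K G : Graph n} {a b} (K⊆G : K ⊆ G) (w : DWalk K a b) →
                   dweight (weaken K⊆G w) ≡ dweight w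
  dweight-weaken K⊆G [] = refl
  dweight-weaken K⊆G (_∷_ {e} _ w) = cong (wt e +_) (dweight-weaken K⊆G w)

  dweight-nonneg : ∀ {G : Graph n} → NonnegWeights G →
                   ∀ {a b} (w : DWalk G a b) → 0# ≤ dweight w
  dweight-nonneg nonneg [] = ≤-refl 0#
  dweight-nonneg nonneg (e∈G ∷ w) = +-nonneg (All.lookup nonneg e∈G) (dweight-nonneg nonneg w)

  module _ {G : Graph n} (acyclic : Acyclic G) where

    loopless : ∀ {e} → e ∈ G → src e ≢ tgt e
    loopless {e} e∈G src≡tgt = acyclic e∈G (subst (DWalk G (tgt e)) (sym src≡tgt) [])

    no-antiparallel : ∀ {e f} → e ∈ G → f ∈ G → ¬ (src e ≡ tgt f × tgt e ≡ src f)
    no-antiparallel {e} e∈G f∈G (refl , refl) = acyclic e∈G (f∈G ∷ [])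

    acyclic⇒simpleU : SimpleD G → SimpleU G
    acyclic⇒simpleU simple =
      All.tabulate loopless ,
      AllPairs.zipWith (λ (not-parallel , not-antiparallel) → [ not-parallel , not-antiparallel ]′)
                       (simple , allPairs-tabulate no-antiparallel)

    vertices : ∀ {a b} → DWalk G a b → List (Fin n)
    vertices {a} [] = a ∷ []
    vertices (_∷_ {e} _ w) = src e ∷ vertices w

    length-vertices : ∀ {a b} (w : DWalk G a b) → length (vertices w) ≡ suc (steps w)
    length-vertices [] = refl
    length-vertices (_ ∷ w) = cong suc (length-vertices w)

    walk-to : ∀ {a b x} (w : DWalk G a b) → x ∈ vertices w → DWalk G a x
    walk-to [] (here refl) = []
    walk-to (_ ∷ w) (here refl) = []
    walk-to (e∈G ∷ w) (there x∈w) = e∈G ∷ walk-to w x∈w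

    vertices-unique : ∀ {a b} (w : DWalk G a b) → Unique (vertices w)
    vertices-unique [] = [] ∷ []
    vertices-unique (e∈G ∷ w) =
      ¬Any⇒All¬ (vertices w) (acyclic e∈G ∘ walk-to w) ∷ vertices-unique w

    steps<n : ∀ {a b} (w : DWalk G a b) → steps w < n
    steps<n w = subst (ℕ._≤ n) (length-vertices w) (unique⇒length≤ (vertices-unique w))

module LongestWalks (ℝ : RealField) {n : ℕ} (G : WithReals.Graph ℝ n) where
  open WithReals ℝ
  open Walks ℝ

  outgoing : Fin n → List (Edge n)
  outgoing v = filter (λ e → src e ≟ v) G

  height : ℕ → Fin n → ℕ
  height zero v = 0
  height (suc i) v = max 0 (map (λ e → suc (height i (tgt e))) (outgoing v))

  height-attained : ∀ i v → ∃₂ λ t (w : DWalk G v t) → steps w ≡ height i v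
  height-attained zero v = v , [] , refl
  height-attained (suc i) v with argmax-sel id 0 (map (λ e → suc (height i (tgt e))) (outgoing v))
  ... | inj₁ height≡0 = v , [] , sym height≡0
  ... | inj₂ height∈ with ∈-map⁻ _ height∈
  ...   | e , e∈out , height≡ with ∈-filter⁻ (λ e → src e ≟ v) e∈out
  ...     | e∈G , refl with height-attained i (tgt e)
  ...       | t , w , steps≡ = t , e∈G ∷ w , trans (cong suc steps≡) (sym height≡)

  height-maximal : ∀ i {v t} (w : DWalk G v t) → steps w ℕ.≤ i → steps w ℕ.≤ height i v
  height-maximal i [] _ = z≤n
  height-maximal (suc i) (_∷_ {e} e∈G w) (s≤s steps≤i) =
    ℕₚ.≤-trans (s≤s (height-maximal i w steps≤i))
               (All.lookup (xs≤max 0 _) (∈-map⁺ _ (∈-filter⁺ (λ f → src f ≟ src e) e∈G refl)))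

  rank : Fin n → ℕ
  rank = height n

  rank-decreasing : Acyclic G → ∀ {e} → e ∈ G → rank (tgt e) < rank (src e)
  rank-decreasing acyclic {e} e∈G with height-attained n (tgt e)
  ... | _ , w , steps≡ =
    subst (_< rank (src e)) steps≡
          (height-maximal n (e∈G ∷ w) (<⇒≤ (steps<n acyclic (e∈G ∷ w))))

module Reweighting (ℝ : RealField) {n : ℕ} (φ : Fin n → RealField.Carrier ℝ) where
  open WithReals ℝ
  open RealFieldProperties ℝ

  reweight : Edge n → Edge n
  reweight e = edge (src e) (tgt e) (wt e + (φ (src e) - φ (tgt e)))

  reweight-simpleU : ∀ {G : Graph n} → SimpleU G → SimpleU (map reweight G)
  reweight-simpleU (loopless , pairs) = All.map⁺ loopless , AllPairs.map⁺ pairs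

  undirect : ∀ {K : Graph n} {a b} → DWalk K a b → UWalk (map reweight K) a b
  undirect [] = []
  undirect (e∈K ∷ w) = fwd (∈-map⁺ reweight e∈K) (undirect w)

  uweight-undirect : ∀ {K : Graph n} {a b} (w : DWalk K a b) →
                     uweight (undirect w) ≡ dweight w + (φ a - φ b)
  uweight-undirect {a = a} [] = begin-equality
    0#                ≡⟨ +-identityʳ 0# ⟨
    0# + 0#           ≡⟨ cong (0# +_) (-‿inverseʳ (φ a)) ⟨
    0# + (φ a - φ a)  ∎
  uweight-undirect {b = b} (_∷_ {e} _ w) = begin-equality
    (wt e + (φ (src e) - φ (tgt e))) + uweight (undirect w)
      ≡⟨ cong (_ +_) (uweight-undirect w) ⟩
    (wt e + (φ (src e) - φ (tgt e))) + (dweight w + (φ (tgt e) - φ b))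
      ≡⟨ interchange (wt e) _ (dweight w) _ ⟩
    (wt e + dweight w) + ((φ (src e) - φ (tgt e)) + (φ (tgt e) - φ b))
      ≡⟨ cong (wt e + dweight w +_) ([x-y]+[y-z]≡x-z (φ (src e)) (φ (tgt e)) (φ b)) ⟩
    (wt e + dweight w) + (φ (src e) - φ b)
      ∎

  backtracks : ∀ {K : Graph n} {a b} → UWalk K a b → ℕ
  backtracks [] = 0
  backtracks (fwd _ u) = backtracks u
  backtracks (bwd _ u) = suc (backtracks u)

  backtrack-free⇒directed : ∀ {K : Graph n} {a b} (u : UWalk (map reweight K) a b) →
                            backtracks u ≡ 0 →
                            Σ (DWalk K a b) λ w → uweight u ≡ uweight (undirect w)
  backtrack-free⇒directed [] _ = [] , refl
  backtrack-free⇒directed (fwd e∈ u) no-backtracks with ∈-map⁻ reweight e∈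
  ... | e , e∈K , refl with backtrack-free⇒directed u no-backtracks
  ...   | w , u≡w = e∈K ∷ w , cong (_ +_) u≡w

  IsUDist⇒IsDDist : ∀ {K : Graph n} {a b d} → IsUDist (map reweight K) a b (d + (φ a - φ b)) →
                    Σ (DWalk K a b) (λ w → dweight w ≡ d) → IsDDist K a b d
  IsUDist⇒IsDDist (_ , shortest) attained =
    attained , λ w → +-cancelʳ-≤ _ (subst (_ ≤_) (uweight-undirect w) (shortest (undirect w)))

  module _ {K : Graph n} {M : Carrier} (0≤M : 0# ≤ M) (nonneg : NonnegWeights K)
           (drop : ∀ {e} → e ∈ K → M ≤ φ (src e) - φ (tgt e)) where

    uweight-lower-bound : ∀ {a b} (u : UWalk (map reweight K) a b) →
                          (φ a - φ b) + backtracks u · (M + M) ≤ uweight u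
    uweight-lower-bound {a} [] = begin
      (φ a - φ a) + 0#   ≡⟨ +-identityʳ _ ⟩
      φ a - φ a          ≡⟨ -‿inverseʳ (φ a) ⟩
      0#                 ∎
    uweight-lower-bound {b = b} (fwd e∈ u) with ∈-map⁻ reweight e∈
    ... | e , e∈K , refl = begin
      (φ (src e) - φ b) + X
        ≡⟨ cong (_+ X) ([x-y]+[y-z]≡x-z _ _ _) ⟨
      ((φ (src e) - φ (tgt e)) + (φ (tgt e) - φ b)) + X
        ≡⟨ +-assoc _ _ X ⟩
      (φ (src e) - φ (tgt e)) + ((φ (tgt e) - φ b) + X)
        ≤⟨ +-mono-≤ (x≤y+x (All.lookup nonneg e∈K)) (uweight-lower-bound u) ⟩
      (wt e + (φ (src e) - φ (tgt e))) + uweight u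
        ∎
      where
      X : Carrier
      X = backtracks u · (M + M)
    uweight-lower-bound {b = b} (bwd e∈ u) with ∈-map⁻ reweight e∈
    ... | e , e∈K , refl = begin
      (φ (tgt e) - φ b) + ((M + M) + X)
        ≤⟨ +-monoʳ-≤ _ (+-monoˡ-≤ X (+-mono-≤ (drop e∈K) (drop e∈K))) ⟩
      (φ (tgt e) - φ b) + ((δ + δ) + X)
        ≡⟨ x∙yz≈y∙xz _ (δ + δ) X ⟩
      (δ + δ) + ((φ (tgt e) - φ b) + X)
        ≡⟨ +-assoc δ δ _ ⟩
      δ + (δ + ((φ (tgt e) - φ b) + X))
        ≡⟨ cong (δ +_) (+-assoc δ _ X) ⟨
      δ + ((δ + (φ (tgt e) - φ b)) + X)
        ≡⟨ cong (λ y → δ + (y + X)) ([x-y]+[y-z]≡x-z _ _ _) ⟩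
      δ + ((φ (src e) - φ b) + X)
        ≤⟨ +-mono-≤ (x≤y+x (All.lookup nonneg e∈K)) (uweight-lower-bound u) ⟩
      (wt e + δ) + uweight u
        ∎
      where
      X δ : Carrier
      X = backtracks u · (M + M)
      δ = φ (src e) - φ (tgt e)

    no-backtracks : ∀ {L : Graph n} {a b} (u : UWalk (map reweight K) a b) (w : DWalk L a b) →
                    uweight u ≤ uweight (undirect w) → ¬ (M + M ≤ dweight w) →
                    backtracks u ≡ 0
    no-backtracks {a = a} {b} u w u≤w w-light with backtracks u | uweight-lower-bound u
    ... | zero | _ = refl
    ... | suc k | bound = ⊥-elim (w-light (+-cancelˡ-≤ (φ a - φ b) (begin
      (φ a - φ b) + (M + M)
        ≤⟨ +-monoʳ-≤ _ (x≤x+y (·-nonneg k (+-nonneg 0≤M 0≤M))) ⟩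
      (φ a - φ b) + ((M + M) + k · (M + M))  ≤⟨ bound ⟩
      uweight u                              ≤⟨ u≤w ⟩
      uweight (undirect w)                   ≡⟨ uweight-undirect w ⟩
      dweight w + (φ a - φ b)                ≡⟨ +-comm _ _ ⟩
      (φ a - φ b) + dweight w                ∎)))

module Reduction (ℝ : RealField) {n : ℕ} where
  open WithReals ℝ
  open RealFieldProperties ℝ
  open Walks ℝ

  module _ (G : DAG n) (M : Carrier) (0≤M : 0# ≤ M) where
    open DAG G
    open LongestWalks ℝ edges using (rank; rank-decreasing)

    potential : Fin n → Carrier
    potential v = rank v · M

    open Reweighting ℝ potential

    potential-drop : ∀ {e} → e ∈ edges → M ≤ potential (src e) - potential (tgt e)
    potential-drop e∈G = x+y≤z⇒y≤z-x (m<n⇒m·x+x≤n·x 0≤M (rank-decreasing acyclic e∈G))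

    reweighted : UGraph n
    reweighted = record
      { edges = map reweight edges
      ; nonneg = All.map⁺ (All.tabulate λ e∈G →
                   +-nonneg (All.lookup nonneg e∈G) (≤-trans 0≤M (potential-drop e∈G)))
      ; simple = reweight-simpleU (acyclic⇒simpleU acyclic simple)
      }

    directed-distance-preserved :
      ∀ {K s t} → K ⊆ edges → (w₀ : DWalk edges s t) → ¬ (M + M ≤ dweight w₀) →
      Σ Carrier (λ d → IsUDist (map reweight edges) s t d × IsUDist (map reweight K) s t d) →
      Σ Carrier (λ d → IsDDist edges s t d × IsDDist K s t d)
    directed-distance-preserved {K} {s} {t} K⊆G w₀ w₀-light (_ , G-dist , (u , refl) , u-shortest) =
      dweight w ,
      IsUDist⇒IsDDist (subst (IsUDist _ s t) u≡w G-dist) (weaken K⊆G w , dweight-weaken K⊆G w) ,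
      IsUDist⇒IsDDist (subst (IsUDist _ s t) u≡w ((u , refl) , u-shortest)) (w , refl)
      where
      u-directed : Σ (DWalk K s t) λ w → uweight u ≡ uweight (undirect w)
      u-directed = backtrack-free⇒directed u
        (no-backtracks 0≤M (All-resp-⊆ K⊆G nonneg) (potential-drop ∘ Sublist.lookup K⊆G)
                       u w₀ (proj₂ G-dist (undirect w₀)) w₀-light)
      w : DWalk K s t
      w = proj₁ u-directed
      u≡w : uweight u ≡ dweight w + (potential s - potential t)
      u≡w = trans (proj₂ u-directed) (uweight-undirect w)

    LightWalk : Fin n × Fin n → Set
    LightWalk (s , t) = Σ (DWalk edges s t) λ w → ¬ (M + M ≤ dweight w)

    preserver-pullback : ∀ {p k} → UDP≤ n p k →
                         (P : Demands n) → length P ≡ p → DistinctPairs P → All LightWalk P →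
                         Σ (Graph n) (λ H → DPreserver edges P H × length H ℕ.≤ k)
    preserver-pullback {k = k} udp P |P| distinct light
      with udp reweighted P (|P| , distinct , All.map (undirect ∘ proj₁) light)
    ... | H , (H⊆ , H-preserves) , |H|≤k with sublist-of-map edges H⊆
    ...   | H₀ , refl , H₀⊆ =
      H₀ ,
      (H₀⊆ , All.zipWith (λ ((w , w-light) , preserved) →
                            directed-distance-preserved H₀⊆ w w-light preserved)
                         (light , H-preserves)) ,
      subst (ℕ._≤ k) (length-map reweight H₀) |H|≤k

  dadp≤udp : ∀ {p k} → UDP≤ n p k → DADP≤ n p k
  dadp≤udp udp G P (|P| , distinct , walks) =
    preserver-pullback G M 0≤M udp P |P| distinct light-walks
    where
    open DAG G using (edges; nonneg)

    demand-weight : ∀ {x} → DWalk edges (proj₁ x) (proj₂ x) → Carrier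
    demand-weight = dweight

    S : Carrier
    S = ∑ demand-weight walks

    0≤S : 0# ≤ S
    0≤S = ∑-nonneg demand-weight (dweight-nonneg nonneg) walks

    M : Carrier
    M = 1# + S

    0≤M : 0# ≤ M
    0≤M = +-nonneg 0≤1 0≤S

    light-walks : All (LightWalk G M 0≤M) P
    light-walks = All.tabulate λ x∈P → All.lookup walks x∈P , λ heavy →
      [1+x]+[1+x]≰x 0≤S
        (≤-trans heavy (lookup≤∑ demand-weight (dweight-nonneg nonneg) walks x∈P))

open import Data.Nat using (_≤_)

lemma4p6 : (ℝ : RealField) (n p : ℕ) → 1 ≤ n → 1 ≤ p →
    ∀ k → WithReals.UDP≤ ℝ n p k → WithReals.DADP≤ ℝ n p k
lemma4p6 ℝ n p _ _ k = Reduction.dadp≤udp ℝ
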